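{- Let $b\geq3$ and $t\geq1$ be integers. Let $T$ be a tree with exactly $b$ leaves and diameter at most $4t$. Then the maximum matching number of $T$ is at most $bt$.
   Context: Leaves are vertices of degree $1$. The diameter is the maximum distance (number of edges of a shortest path) between two vertices. The maximum matching number is the largest number of pairwise vertex-disjoint edges. -}

module Defs where

open import Data.Nat using (ℕ; zero; suc; _+_; _≤_)
open import Data.Fin using (Fin)
open import Data.Fin.Properties using (all?)
open import Data.List using (List; []; _∷_; length; filter)
open import Data.List.Base using (allFin)
open import Data.List.Relation.Unary.All using (All)
open import Data.List.Membership.Propositional using (_∈_)
open import Data.List.Relation.Unary.AllPairs using (AllPairs)
open import Data.List.Relation.Unary.Unique.Propositional using (Unique)
open import Data.Product using (Σ; _×_; _,_; ∃)
open import Relation.Nullary using (¬_; Dec)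
open import Relation.Binary.PropositionalEquality using (_≡_)

record Graph (n : ℕ) : Set₁ where
  field
    Adj    : Fin n → Fin n → Set
    adj?   : ∀ u v → Dec (Adj u v)
    sym    : ∀ {u v} → Adj u v → Adj v u
    irrefl : ∀ {u} → ¬ Adj u u

module _ {n : ℕ} (G : Graph n) where
  open Graph G

  data Walk : Fin n → Fin n → Set where
    [] : ∀ {u} → Walk u u
    _∷_ : ∀ {u v w} → Adj u v → Walk v w → Walk u w

  walkLength : ∀ {u v} → Walk u v → ℕ
  walkLength [] = zero
  walkLength (_ ∷ p) = suc (walkLength p)

  support : ∀ {u v} → Walk u v → List (Fin n)
  support {u} [] = u ∷ []
  support {u} (_ ∷ p) = u ∷ support p

  IsPath : ∀ {u v} → Walk u v → Set
  IsPath p = Unique (support p)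

  Connected : Set
  Connected = ∀ u v → Walk u v

  HasCycle : Set
  HasCycle = Σ (Fin n) λ u → Σ (Fin n) λ v → Σ (Walk u v) λ p →
               IsPath p × (2 ≤ walkLength p) × Adj v u

  IsTree : Set
  IsTree = Connected × ¬ HasCycle

  degree : Fin n → ℕ
  degree v = length (filter (adj? v) (allFin n))

  IsLeaf : Fin n → Set
  IsLeaf v = degree v ≡ 1

  HasLeafCount : ℕ → Set
  HasLeafCount b = Σ (List (Fin n)) λ ls →
    Unique ls × length ls ≡ b × (∀ v → IsLeaf v → v ∈ ls)
      × All IsLeaf ls

  DiameterAtMost : ℕ → Set
  DiameterAtMost D = ∀ u v → Σ (Walk u v) λ p → walkLength p ≤ D

  Edge : Set
  Edge = Σ (Fin n) λ u → Σ (Fin n) λ v → Adj u v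

  Disjoint : Edge → Edge → Set
  Disjoint (a , b , _) (c , d , _) = ¬ a ≡ c × ¬ a ≡ d × ¬ b ≡ c × ¬ b ≡ d

  IsMatching : List Edge → Set
  IsMatching = AllPairs Disjoint

  MatchingNumberAtMost : ℕ → Set
  MatchingNumberAtMost k = ∀ M → IsMatching M → length M ≤ k

-- A tree of diameter at most 2r has a centre c from which every vertex is
-- within distance r.  Indeed, if some vertex x is farther than r from c, let
-- c' be the neighbour of c towards x.  A vertex y whose path from c avoids c'
-- satisfies d(x,c) + d(c,y) = d(x,y) ≤ 2r, so d(c',y) = d(c,y) + 1 ≤ r; every
-- other vertex is one step closer to c' than to c.  So the eccentricity can be
-- lowered until it is at most r.  Every vertex other than c lies on the path
-- from c to some leaf, and each of these b paths has at most r vertices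
-- besides c.  With r = 2t a tree has at most 1 + 2bt vertices, so a matching
-- has at most bt edges.
module Submission where

open import Defs
open import Data.Nat using (ℕ; zero; suc; _+_; _*_; _≤_; _<_; z≤n; s≤s; _<?_)
import Data.Nat as ℕ
open import Data.Nat.Properties
  using (≤-refl; ≤-trans; ≤-reflexive; ≤-pred; <⇒≱; ≮⇒≥; m<1+n⇒m≤n; m≤n+m; n≤1+n; suc-injective;
         +-comm; +-suc; +-identityʳ; +-mono-≤; +-monoˡ-≤; +-cancelˡ-≤;
         *-suc; *-assoc; *-comm; *-cancelˡ-<;
         module ≤-Reasoning)
open import Data.Fin using (Fin; _≟_)
open import Data.Fin.Properties using (any?; injective⇒≤)
open import Data.List using (List; []; _∷_; _++_; length; reverse; lookup; concatMap; allFin)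
open import Data.List.Properties using (length-++; length-tabulate; unfold-reverse)
open import Data.List.Membership.Propositional using (_∈_; _∉_; lose)
open import Data.List.Membership.Propositional.Properties
  using (∈-lookup; ∈-++⁻; ∈-filter⁺; ∈-filter⁻; ∈-allFin; ∈-concatMap⁺)
import Data.List.Membership.DecPropositional as DecMembership
import Data.List.Membership.Setoid.Properties as SetoidMembership
open import Data.List.Relation.Binary.Subset.Propositional using (_⊆_)
import Data.List.Relation.Binary.Disjoint.Propositional as Lists
import Data.List.Relation.Binary.Permutation.Setoid as Permutation
import Data.List.Relation.Binary.Permutation.Setoid.Properties as PermutationProperties
open import Data.List.Relation.Unary.All using (All; []; _∷_)
open import Data.List.Relation.Unary.All.Properties using (¬Any⇒All¬)
open import Data.List.Relation.Unary.Any using (here; there)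
import Data.List.Relation.Unary.Any.Properties as Any
open import Data.List.Relation.Unary.AllPairs using ([]; _∷_)
open import Data.List.Relation.Unary.Unique.Propositional using (Unique)
import Data.List.Relation.Unary.Unique.Propositional.Properties as Unique
open import Data.List.Relation.Unary.Unique.Propositional.Properties using (Unique[x∷xs]⇒x∉xs)
open import Data.Product using (Σ; ∃; _×_; _,_; proj₁; proj₂)
open import Data.Sum using (_⊎_; inj₁; inj₂)
open import Data.Empty using (⊥; ⊥-elim)
open import Function using (_∘_; id)
open import Relation.Nullary using (¬_; yes; no; contradiction)
open import Relation.Binary.PropositionalEquality
  using (_≡_; _≢_; refl; sym; trans; cong; subst; setoid; module ≡-Reasoning)

module _ {a} {A : Set a} where

  Unique⇒lookup-injective : ∀ {xs : List A} → Unique xs →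
                            ∀ {i j} → lookup xs i ≡ lookup xs j → i ≡ j
  Unique⇒lookup-injective {_ ∷ _}  _          {Fin.zero}  {Fin.zero}  _  = refl
  Unique⇒lookup-injective {_ ∷ xs} xs!        {Fin.zero}  {Fin.suc j} eq =
    contradiction (subst (_∈ xs) (sym eq) (∈-lookup j)) (Unique[x∷xs]⇒x∉xs xs!)
  Unique⇒lookup-injective {_ ∷ xs} xs!        {Fin.suc i} {Fin.zero}  eq =
    contradiction (subst (_∈ xs) eq (∈-lookup i)) (Unique[x∷xs]⇒x∉xs xs!)
  Unique⇒lookup-injective {_ ∷ _}  (_ ∷ xs!)  {Fin.suc i} {Fin.suc j} eq =
    cong Fin.suc (Unique⇒lookup-injective xs! eq)

  Unique-⊆⇒length≤ : ∀ {xs ys : List A} → Unique xs → xs ⊆ ys → length xs ≤ length ys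
  Unique-⊆⇒length≤ xs! xs⊆ys = injective⇒≤ λ {i} {j} eq →
    Unique⇒lookup-injective xs!
      (SetoidMembership.index-injective (setoid A) (xs⊆ys (∈-lookup i)) (xs⊆ys (∈-lookup j)) eq)

  Unique-reverse : ∀ {xs : List A} → Unique xs → Unique (reverse xs)
  Unique-reverse {xs} = Unique-resp-↭ (↭-sym (↭-reverse xs))
    where
      open Permutation (setoid A) using (↭-sym)
      open PermutationProperties (setoid A) using (Unique-resp-↭; ↭-reverse)

  other-member : ∀ {xs : List A} {y} → Unique xs → y ∈ xs → length xs ≢ 1 →
                 ∃ λ x → x ∈ xs × x ≢ y
  other-member {_ ∷ []}    _                (here refl)  length≢1 = contradiction refl length≢1
  other-member {_ ∷ _ ∷ _} ((x≢x′ ∷ _) ∷ _) (here refl)  _        = _ , there (here refl) , x≢x′ ∘ sym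
  other-member {_ ∷ _ ∷ _} xs!              (there y∈xs) _        =
    _ , here refl , λ { refl → Unique[x∷xs]⇒x∉xs xs! y∈xs }

  length-concatMap≤ : ∀ {b} {B : Set b} (f : A → List B) {r} → (∀ x → length (f x) ≤ r) →
                      ∀ xs → length (concatMap f xs) ≤ length xs * r
  length-concatMap≤ f f≤r []       = z≤n
  length-concatMap≤ f f≤r (x ∷ xs) = ≤-trans (≤-reflexive (length-++ (f x)))
                                             (+-mono-≤ (f≤r x) (length-concatMap≤ f f≤r xs))

Unique⇒length≤ : ∀ {n} {xs : List (Fin n)} → Unique xs → length xs ≤ n
Unique⇒length≤ {n} {xs} xs! =
  subst (length xs ≤_) (length-tabulate id) (Unique-⊆⇒length≤ xs! (λ _ → ∈-allFin _))

covering⇒≤length : ∀ {n} {xs : List (Fin n)} → (∀ v → v ∈ xs) → n ≤ length xs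
covering⇒≤length {n} {xs} covers =
  subst (_≤ length xs) (length-tabulate id)
        (Unique-⊆⇒length≤ (Unique.allFin⁺ n) (λ {v} _ → covers v))

halve : ∀ {m k} → 2 * m ≤ suc (2 * k) → m ≤ k
halve {m} {k} 2m≤1+2k =
  m<1+n⇒m≤n (*-cancelˡ-< 2 m (suc k) (subst (2 * m <_) (sym (*-suc 2 k)) (s≤s 2m≤1+2k)))

m+n≤2o∧o<m⇒n<o : ∀ {m n o} → m + n ≤ 2 * o → o < m → n < o
m+n≤2o∧o<m⇒n<o {m} {n} {o} m+n≤2o o<m = +-cancelˡ-≤ o (suc n) o (begin
  o + suc n   ≡⟨ +-suc o n ⟩
  suc o + n   ≤⟨ +-monoˡ-≤ n o<m ⟩
  m + n       ≤⟨ m+n≤2o ⟩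
  o + (o + 0) ≡⟨ cong (o +_) (+-identityʳ o) ⟩
  o + o       ∎)
  where open ≤-Reasoning

module Walks {n : ℕ} (G : Graph n) where
  open Graph G using (Adj) renaming (sym to Adj-sym)
  open DecMembership (_≟_ {n}) using (_∈?_)

  private variable u v w x : Fin n

  infixr 5 _++ʷ_
  _++ʷ_ : Walk G u v → Walk G v w → Walk G u w
  []      ++ʷ q = q
  (e ∷ p) ++ʷ q = e ∷ (p ++ʷ q)

  reverseʷ : Walk G u v → Walk G v u
  reverseʷ []      = []
  reverseʷ (e ∷ p) = reverseʷ p ++ʷ (Adj-sym e ∷ [])

  tailSupport : Walk G u v → List (Fin n)
  tailSupport []      = []
  tailSupport (_ ∷ p) = support G p

  support≡∷tailSupport : (p : Walk G u v) → support G p ≡ u ∷ tailSupport p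
  support≡∷tailSupport []      = refl
  support≡∷tailSupport (_ ∷ _) = refl

  source∈support : (p : Walk G u v) → u ∈ support G p
  source∈support p = subst (_ ∈_) (sym (support≡∷tailSupport p)) (here refl)

  target∈support : (p : Walk G u v) → v ∈ support G p
  target∈support []      = here refl
  target∈support (_ ∷ p) = there (target∈support p)

  ∈-tailSupport : (p : Walk G u v) → x ≢ u → x ∈ support G p → x ∈ tailSupport p
  ∈-tailSupport p x≢u x∈p with subst (_ ∈_) (support≡∷tailSupport p) x∈p
  ... | here x≡u  = contradiction x≡u x≢u
  ... | there x∈t = x∈t

  length-support : (p : Walk G u v) → length (support G p) ≡ suc (walkLength G p)
  length-support []      = refl
  length-support (_ ∷ p) = cong suc (length-support p)

  length-tailSupport : (p : Walk G u v) → length (tailSupport p) ≡ walkLength G p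
  length-tailSupport []      = refl
  length-tailSupport (_ ∷ p) = length-support p

  isPath⇒walkLength< : {p : Walk G u v} → IsPath G p → walkLength G p < n
  isPath⇒walkLength< {p = p} p! = subst (_≤ n) (length-support p) (Unique⇒length≤ p!)

  walkLength-++ʷ : (p : Walk G u v) (q : Walk G v w) →
                   walkLength G (p ++ʷ q) ≡ walkLength G p + walkLength G q
  walkLength-++ʷ []      q = refl
  walkLength-++ʷ (_ ∷ p) q = cong suc (walkLength-++ʷ p q)

  support-++ʷ : (p : Walk G u v) (q : Walk G v w) →
                support G (p ++ʷ q) ≡ support G p ++ tailSupport q
  support-++ʷ []      q = support≡∷tailSupport q
  support-++ʷ (_ ∷ p) q = cong (_ ∷_) (support-++ʷ p q)

  ∈-support-++ʷ⁻ : (p : Walk G u v) {q : Walk G v w} →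
                   x ∈ support G (p ++ʷ q) → x ∈ support G p ⊎ x ∈ support G q
  ∈-support-++ʷ⁻ p {q} x∈pq with ∈-++⁻ (support G p) (subst (_ ∈_) (support-++ʷ p q) x∈pq)
  ... | inj₁ x∈p = inj₁ x∈p
  ... | inj₂ x∈q = inj₂ (subst (_ ∈_) (sym (support≡∷tailSupport q)) (there x∈q))

  walkLength-reverseʷ : (p : Walk G u v) → walkLength G (reverseʷ p) ≡ walkLength G p
  walkLength-reverseʷ []      = refl
  walkLength-reverseʷ (e ∷ p) = begin
    walkLength G (reverseʷ p ++ʷ (Adj-sym e ∷ [])) ≡⟨ walkLength-++ʷ (reverseʷ p) _ ⟩
    walkLength G (reverseʷ p) + 1                  ≡⟨ cong (_+ 1) (walkLength-reverseʷ p) ⟩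
    walkLength G p + 1                             ≡⟨ +-comm _ 1 ⟩
    suc (walkLength G p)                           ∎
    where open ≡-Reasoning

  support-reverseʷ : (p : Walk G u v) → support G (reverseʷ p) ≡ reverse (support G p)
  support-reverseʷ []          = refl
  support-reverseʷ {u} (e ∷ p) = begin
    support G (reverseʷ p ++ʷ (Adj-sym e ∷ [])) ≡⟨ support-++ʷ (reverseʷ p) _ ⟩
    support G (reverseʷ p) ++ u ∷ []            ≡⟨ cong (_++ u ∷ []) (support-reverseʷ p) ⟩
    reverse (support G p) ++ u ∷ []             ≡⟨ unfold-reverse u (support G p) ⟨
    reverse (u ∷ support G p)                   ∎
    where open ≡-Reasoning

  reverseʷ-⊆ : (p : Walk G u v) → support G (reverseʷ p) ⊆ support G p
  reverseʷ-⊆ p = Any.reverse⁻ ∘ subst (_ ∈_) (support-reverseʷ p)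

  ⊆-reverseʷ : (p : Walk G u v) → support G p ⊆ support G (reverseʷ p)
  ⊆-reverseʷ p = subst (_ ∈_) (sym (support-reverseʷ p)) ∘ Any.reverse⁺

  isPath-reverseʷ : {p : Walk G u v} → IsPath G p → IsPath G (reverseʷ p)
  isPath-reverseʷ {p = p} p! = subst Unique (sym (support-reverseʷ p)) (Unique-reverse p!)

  isPath-++ʷ : {p : Walk G u v} {q : Walk G v w} → IsPath G p → IsPath G q →
               Lists.Disjoint (support G p) (tailSupport q) → IsPath G (p ++ʷ q)
  isPath-++ʷ {p = p} {q} p! q! disjoint =
    subst Unique (sym (support-++ʷ p q)) (Unique.++⁺ p! (tail-unique q q!) disjoint)
    where
      tail-unique : (q : Walk G v w) → IsPath G q → Unique (tailSupport q)
      tail-unique []      _         = []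
      tail-unique (_ ∷ _) (_ ∷ q!) = q!

  takeUntil : (p : Walk G u v) → x ∈ support G p → Walk G u x
  takeUntil []      (here refl) = []
  takeUntil (_ ∷ _) (here refl) = []
  takeUntil (e ∷ p) (there x∈p) = e ∷ takeUntil p x∈p

  takeUntil-⊆ : (p : Walk G u v) (x∈p : x ∈ support G p) → support G (takeUntil p x∈p) ⊆ support G p
  takeUntil-⊆ []      (here refl) = id
  takeUntil-⊆ (_ ∷ _) (here refl) (here refl) = here refl
  takeUntil-⊆ (_ ∷ p) (there x∈p) (here refl) = here refl
  takeUntil-⊆ (_ ∷ p) (there x∈p) (there y∈) = there (takeUntil-⊆ p x∈p y∈)

  dropUntil : (p : Walk G u v) → x ∈ support G p → Walk G x v
  dropUntil []      (here refl) = []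
  dropUntil (e ∷ p) (here refl) = e ∷ p
  dropUntil (_ ∷ p) (there x∈p) = dropUntil p x∈p

  dropUntil-⊆ : (p : Walk G u v) (x∈p : x ∈ support G p) → support G (dropUntil p x∈p) ⊆ support G p
  dropUntil-⊆ []      (here refl) = id
  dropUntil-⊆ (_ ∷ _) (here refl) = id
  dropUntil-⊆ (_ ∷ p) (there x∈p) = there ∘ dropUntil-⊆ p x∈p

  walkLength-dropUntil : (p : Walk G u v) (x∈p : x ∈ support G p) →
                         walkLength G (dropUntil p x∈p) ≤ walkLength G p
  walkLength-dropUntil []      (here refl) = z≤n
  walkLength-dropUntil (_ ∷ p) (here refl) = ≤-refl
  walkLength-dropUntil (_ ∷ p) (there x∈p) = ≤-trans (walkLength-dropUntil p x∈p) (n≤1+n _)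

  isPath-dropUntil : (p : Walk G u v) (x∈p : x ∈ support G p) →
                     IsPath G p → IsPath G (dropUntil p x∈p)
  isPath-dropUntil []      (here refl) p!       = p!
  isPath-dropUntil (_ ∷ _) (here refl) p!       = p!
  isPath-dropUntil (_ ∷ p) (there x∈p) (_ ∷ p!) = isPath-dropUntil p x∈p p!

  toPath : (p : Walk G u v) → Σ (Walk G u v) λ q →
           IsPath G q × walkLength G q ≤ walkLength G p × support G q ⊆ support G p
  toPath []              = [] , [] ∷ [] , z≤n , id
  toPath {u} (e ∷ p) with toPath p
  ... | q , q! , q≤p , q⊆p with u ∈? support G q
  ...   | yes u∈q = dropUntil q u∈q , isPath-dropUntil q u∈q q!
                  , ≤-trans (walkLength-dropUntil q u∈q) (≤-trans q≤p (n≤1+n _))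
                  , there ∘ q⊆p ∘ dropUntil-⊆ q u∈q
  ...   | no  u∉q = e ∷ q , ¬Any⇒All¬ _ u∉q ∷ q! , s≤s q≤p
                  , λ { (here refl) → here refl ; (there y∈q) → there (q⊆p y∈q) }

  EccentricityAtMost : Fin n → ℕ → Set
  EccentricityAtMost c e = ∀ y → Σ (Walk G c y) λ p → IsPath G p × walkLength G p ≤ e

  eccentricity≤diameter : ∀ {D} → DiameterAtMost G D → ∀ c → EccentricityAtMost c D
  eccentricity≤diameter diam c y =
    let w , w≤D = diam c y
        p , p! , p≤w , _ = toPath w
    in p , p! , ≤-trans p≤w w≤D

module Acyclic {n : ℕ} (G : Graph n) (acyclic : ¬ HasCycle G) where
  open Graph G using (Adj; adj?; irrefl) renaming (sym to Adj-sym)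
  open Walks G
  open DecMembership (_≟_ {n}) using (_∈?_)

  private variable a a′ c c′ u v w x : Fin n

  neighbours-linked-avoiding⇒≡ : Adj u a → Adj u a′ → (p : Walk G a a′) → u ∉ support G p → a ≡ a′
  neighbours-linked-avoiding⇒≡ {u} e e′ p u∉p with toPath p
  ... | []          , _ = refl
  ... | q@(_ ∷ _) , q! , _ , q⊆p =
    ⊥-elim (acyclic (u , _ , e ∷ q , ¬Any⇒All¬ _ (u∉p ∘ q⊆p) ∷ q! , s≤s (s≤s z≤n) , Adj-sym e′))

  branches-meet⇒same-first-step : Adj u a → Adj u a′ → (p : Walk G a v) (q : Walk G a′ w) →
    u ∉ support G p → u ∉ support G q → x ∈ support G p → x ∈ support G q → a ≡ a′
  branches-meet⇒same-first-step e e′ p q u∉p u∉q x∈p x∈q =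
    neighbours-linked-avoiding⇒≡ e e′ (p′ ++ʷ reverseʷ q′) u∉detour
    where
      p′ = takeUntil p x∈p
      q′ = takeUntil q x∈q
      u∉detour : _ ∉ support G (p′ ++ʷ reverseʷ q′)
      u∉detour u∈ with ∈-support-++ʷ⁻ p′ u∈
      ... | inj₁ u∈p′ = u∉p (takeUntil-⊆ p x∈p u∈p′)
      ... | inj₂ u∈q′ = u∉q (takeUntil-⊆ q x∈q (reverseʷ-⊆ q′ u∈q′))

  path-support-unique : (p q : Walk G u v) → IsPath G p → IsPath G q → support G p ≡ support G q
  path-support-unique []      []      _ _ = refl
  path-support-unique []      (_ ∷ q) _ q! = contradiction (target∈support q) (Unique[x∷xs]⇒x∉xs q!)
  path-support-unique (_ ∷ p) []      p! _ = contradiction (target∈support p) (Unique[x∷xs]⇒x∉xs p!)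
  path-support-unique (e ∷ p) (e′ ∷ q) p!@(_ ∷ p′!) q!@(_ ∷ q′!)
    with branches-meet⇒same-first-step e e′ p q (Unique[x∷xs]⇒x∉xs p!) (Unique[x∷xs]⇒x∉xs q!)
                                            (target∈support p) (target∈support q)
  ... | refl = cong (_ ∷_) (path-support-unique p q p′! q′!)

  path-length-unique : (p q : Walk G u v) → IsPath G p → IsPath G q →
                       walkLength G p ≡ walkLength G q
  path-length-unique p q p! q! = suc-injective (begin
    suc (walkLength G p)   ≡⟨ length-support p ⟨
    length (support G p)   ≡⟨ cong length (path-support-unique p q p! q!) ⟩
    length (support G q)   ≡⟨ length-support q ⟩
    suc (walkLength G q)   ∎)
    where open ≡-Reasoning

  path-length≤diameter : ∀ {D} → DiameterAtMost G D → (p : Walk G u v) → IsPath G p →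
                         walkLength G p ≤ D
  path-length≤diameter {u} {v} diam p p! =
    let w , w≤D = diam u v
        q , q! , q≤w , _ = toPath w
    in ≤-trans (≤-reflexive (path-length-unique p q p! q!)) (≤-trans q≤w w≤D)

  branches-join-to-path : (s : Adj c c′) (X : Walk G c′ x) (Y : Walk G c v) →
    IsPath G (s ∷ X) → IsPath G Y → c′ ∉ support G Y → IsPath G (reverseʷ (s ∷ X) ++ʷ Y)
  branches-join-to-path {c} {c′} s X Y sX! Y! c′∉Y =
    isPath-++ʷ (isPath-reverseʷ sX!) Y! λ (z∈X , z∈Y) →
      disjoint Y Y! c′∉Y (reverseʷ-⊆ (s ∷ X) z∈X) z∈Y
    where
      disjoint : ∀ {v z} (Y : Walk G c v) → IsPath G Y → c′ ∉ support G Y →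
                 z ∈ support G (s ∷ X) → z ∈ tailSupport Y → ⊥
      disjoint []       _  _    _             ()
      disjoint (_ ∷ Y′) Y! _    (here refl)   z∈Y′ = Unique[x∷xs]⇒x∉xs Y! z∈Y′
      disjoint (s′ ∷ Y′) Y! c′∉Y (there z∈X) z∈Y′
        with branches-meet⇒same-first-step s s′ X Y′
               (Unique[x∷xs]⇒x∉xs sX!) (Unique[x∷xs]⇒x∉xs Y!) z∈X z∈Y′
      ... | refl = c′∉Y (there (source∈support Y′))

  far-vertex⇒smaller-eccentricity : ∀ {r e} → DiameterAtMost G (2 * r) →
    (X : Walk G c x) → IsPath G X → r < walkLength G X → walkLength G X ≤ suc e →
    EccentricityAtMost c (suc e) → ∃ λ c′ → EccentricityAtMost c′ e
  far-vertex⇒smaller-eccentricity {c} {r = r} {e} diam (_∷_ {v = c′} s X) sX! r<sX sX≤1+e ecc =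
    c′ , reach
    where
      r≤e : r ≤ e
      r≤e = ≤-pred (≤-trans r<sX sX≤1+e)

      behind-c′ : ∀ {y} (Y : Walk G c y) → IsPath G Y → walkLength G Y ≤ suc e → c′ ∈ support G Y →
                  Σ (Walk G c′ y) λ p → IsPath G p × walkLength G p ≤ e
      behind-c′ []       _        _          (here c′≡c) = ⊥-elim (irrefl (subst (Adj c) c′≡c s))
      behind-c′ (_ ∷ _)  _        _          (here c′≡c) = ⊥-elim (irrefl (subst (Adj c) c′≡c s))
      behind-c′ (_ ∷ Y)  (_ ∷ Y!) (s≤s Y≤e) (there c′∈Y) =
        dropUntil Y c′∈Y , isPath-dropUntil Y c′∈Y Y! , ≤-trans (walkLength-dropUntil Y c′∈Y) Y≤e

      beside-c′ : ∀ {y} (Y : Walk G c y) → IsPath G Y → c′ ∉ support G Y → suc (walkLength G Y) ≤ e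
      beside-c′ Y Y! c′∉Y = ≤-trans (m+n≤2o∧o<m⇒n<o sX+Y≤2r r<sX) r≤e
        where
          sX+Y≤2r : walkLength G (s ∷ X) + walkLength G Y ≤ 2 * r
          sX+Y≤2r = subst (_≤ 2 * r)
            (trans (walkLength-++ʷ (reverseʷ (s ∷ X)) Y)
                   (cong (_+ _) (walkLength-reverseʷ (s ∷ X))))
            (path-length≤diameter diam _ (branches-join-to-path s X Y sX! Y! c′∉Y))

      reach : EccentricityAtMost c′ e
      reach y with ecc y
      ... | Y , Y! , Y≤1+e with c′ ∈? support G Y
      ...   | yes c′∈Y = behind-c′ Y Y! Y≤1+e c′∈Y
      ...   | no  c′∉Y = Adj-sym s ∷ Y , ¬Any⇒All¬ _ c′∉Y ∷ Y! , beside-c′ Y Y! c′∉Y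

  centre : ∀ {r} → DiameterAtMost G (2 * r) → Fin n → ∃ λ c → EccentricityAtMost c r
  centre {r} diam c₀ = descend (2 * r) c₀ (eccentricity≤diameter diam c₀)
    where
      descend : ∀ e c → EccentricityAtMost c e → ∃ λ c′ → EccentricityAtMost c′ r
      descend zero    c ecc = c , λ y → let p , p! , p≤0 = ecc y in p , p! , ≤-trans p≤0 z≤n
      descend (suc e) c ecc with any? (λ x → r <? walkLength G (proj₁ (ecc x)))
      ... | yes (x , far) = let X , X! , X≤1+e = ecc x
                                c′ , ecc′ = far-vertex⇒smaller-eccentricity diam X X! far X≤1+e ecc
                            in descend e c′ ecc′
      ... | no  ¬far      = c , λ y → let p , p! , _ = ecc y in p , p! , ≮⇒≥ (¬far ∘ (y ,_))

  LeafPathExtending : Walk G v c → Set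
  LeafPathExtending {c = c} P =
    Σ (Fin n) λ ℓ → IsLeaf G ℓ × Σ (Walk G ℓ c) λ L → IsPath G L × support G P ⊆ support G L

  neighbour-on-path⇒second-vertex : (e : Adj v u) (P : Walk G u c) → IsPath G (e ∷ P) →
                                    Adj v w → w ∈ support G P → w ≡ u
  neighbour-on-path⇒second-vertex {v} {w = w} e P eP! vw w∈P =
    sym (branches-meet⇒same-first-step e vw P [] (Unique[x∷xs]⇒x∉xs eP!) v∉[w] w∈P (here refl))
    where
      v∉[w] : v ∉ w ∷ []
      v∉[w] (here v≡w) = irrefl (subst (Adj v) (sym v≡w) vw)

  another-neighbour : ¬ IsLeaf G v → Adj v u → ∃ λ w → Adj v w × w ≢ u
  another-neighbour {v} {u} ¬leaf e =
    let w , w∈N , w≢u = other-member (Unique.filter⁺ (adj? v) {allFin n} (Unique.allFin⁺ n))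
                                     (∈-filter⁺ (adj? v) (∈-allFin u) e) ¬leaf
    in w , proj₂ (∈-filter⁻ (adj? v) {xs = allFin n} w∈N) , w≢u

  extend-to-leaf : ∀ fuel (e : Adj v u) (P : Walk G u c) → IsPath G (e ∷ P) →
                   n ≤ walkLength G (e ∷ P) + fuel → LeafPathExtending (e ∷ P)
  extend-to-leaf zero e P eP! n≤eP+0 =
    contradiction (subst (n ≤_) (+-identityʳ _) n≤eP+0) (<⇒≱ (isPath⇒walkLength< {p = e ∷ P} eP!))
  extend-to-leaf {v} (suc fuel) e P eP! n≤eP+1+fuel with degree G v ℕ.≟ 1
  ... | yes leaf = v , leaf , e ∷ P , eP! , id
  ... | no ¬leaf =
    let w , vw , w≢u = another-neighbour ¬leaf e
        w∉eP : w ∉ support G (e ∷ P)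
        w∉eP = λ { (here w≡v)  → irrefl (subst (Adj v) w≡v vw)
                 ; (there w∈P) → w≢u (neighbour-on-path⇒second-vertex e P eP! vw w∈P) }
        ℓ , leaf , L , L! , weP⊆L =
          extend-to-leaf fuel (Adj-sym vw) (e ∷ P) (¬Any⇒All¬ _ w∉eP ∷ eP!)
                         (subst (n ≤_) (+-suc _ fuel) n≤eP+1+fuel)
    in ℓ , leaf , L , L! , weP⊆L ∘ there

  on-path-to-leaf : Connected G → v ≢ c →
                    Σ (Fin n) λ ℓ → IsLeaf G ℓ × Σ (Walk G c ℓ) λ L → IsPath G L × v ∈ support G L
  on-path-to-leaf {v} {c} conn v≢c with toPath (conn v c)
  ... | []    , _ = contradiction refl v≢c
  ... | e ∷ P , eP! , _ =
    let ℓ , leaf , L , L! , eP⊆L = extend-to-leaf n e P eP! (m≤n+m n _)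
    in ℓ , leaf , reverseʷ L , isPath-reverseʷ L! , ⊆-reverseʷ L (eP⊆L (here refl))

  order≤1+leaves*eccentricity : ∀ {b r} → Connected G → HasLeafCount G b → EccentricityAtMost c r →
                                n ≤ suc (b * r)
  order≤1+leaves*eccentricity {c} {r = r} conn (leaves , _ , refl , leaf∈leaves , _) ecc =
    ≤-trans (covering⇒≤length covered) (s≤s (length-concatMap≤ spoke spoke≤r leaves))
    where
      spoke : Fin n → List (Fin n)
      spoke ℓ = tailSupport (proj₁ (ecc ℓ))

      spoke≤r : ∀ ℓ → length (spoke ℓ) ≤ r
      spoke≤r ℓ = subst (_≤ r) (sym (length-tailSupport (proj₁ (ecc ℓ)))) (proj₂ (proj₂ (ecc ℓ)))

      covered : ∀ v → v ∈ c ∷ concatMap spoke leaves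
      covered v with v ≟ c
      ... | yes refl = here refl
      ... | no  v≢c  =
        let ℓ , leaf , L , L! , v∈L = on-path-to-leaf conn v≢c
            P , P! , _ = ecc ℓ
            v∈P = subst (v ∈_) (path-support-unique L P L! P!) v∈L
        in there (∈-concatMap⁺ spoke (lose (leaf∈leaves ℓ leaf) (∈-tailSupport P v≢c v∈P)))

tree-order≤ : ∀ {n b r} (T : Graph n) → IsTree T → HasLeafCount T b → DiameterAtMost T (2 * r) →
              n ≤ suc (b * r)
tree-order≤ {zero}  _ _                _      _    = z≤n
tree-order≤ {suc _} T (conn , acyclic) leaves diam =
  let c , ecc = centre diam Fin.zero in order≤1+leaves*eccentricity conn leaves ecc
  where open Acyclic T acyclic

module _ {n : ℕ} (G : Graph n) where
  open Graph G using (Adj; irrefl)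

  matchedVertices : List (Edge G) → List (Fin n)
  matchedVertices []                = []
  matchedVertices ((u , v , _) ∷ M) = u ∷ v ∷ matchedVertices M

  length-matchedVertices : ∀ M → length (matchedVertices M) ≡ 2 * length M
  length-matchedVertices []      = refl
  length-matchedVertices (_ ∷ M) =
    trans (cong (suc ∘ suc) (length-matchedVertices M)) (sym (*-suc 2 (length M)))

  disjoint⇒unmatched : ∀ {u v e M} → All (Disjoint G (u , v , e)) M →
                       All (u ≢_) (matchedVertices M) × All (v ≢_) (matchedVertices M)
  disjoint⇒unmatched [] = [] , []
  disjoint⇒unmatched {u} {v} {e} ((u≢u′ , u≢v′ , v≢u′ , v≢v′) ∷ rest) =
    let u-free , v-free = disjoint⇒unmatched {u} {v} {e} rest
    in (u≢u′ ∷ u≢v′ ∷ u-free) , (v≢u′ ∷ v≢v′ ∷ v-free)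

  matchedVertices-unique : ∀ {M} → IsMatching G M → Unique (matchedVertices M)
  matchedVertices-unique {[]}              []              = []
  matchedVertices-unique {(u , v , e) ∷ M} (disjoint ∷ M!) =
    let u-free , v-free = disjoint⇒unmatched {u} {v} {e} disjoint
    in ((λ u≡v → irrefl (subst (Adj u) (sym u≡v) e)) ∷ u-free) ∷ v-free ∷ matchedVertices-unique M!

lemma2p8 : (b t n : ℕ) → 3 ≤ b → 1 ≤ t → (T : Graph n) → IsTree T →
    HasLeafCount T b → DiameterAtMost T (4 * t) → MatchingNumberAtMost T (b * t)
lemma2p8 b t n _ _ T tree leaves diam M M! = halve (begin
  2 * length M                  ≡⟨ length-matchedVertices T M ⟨
  length (matchedVertices T M)  ≤⟨ Unique⇒length≤ (matchedVertices-unique T M!) ⟩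
  n                             ≤⟨ tree-order≤ T tree leaves diam′ ⟩
  suc (b * (2 * t))             ≡⟨ cong suc b*[2*t]≡2*[b*t] ⟩
  suc (2 * (b * t))             ∎)
  where
    open ≤-Reasoning
    diam′ : DiameterAtMost T (2 * (2 * t))
    diam′ = subst (DiameterAtMost T) (*-assoc 2 2 t) diam
    b*[2*t]≡2*[b*t] : b * (2 * t) ≡ 2 * (b * t)
    b*[2*t]≡2*[b*t] = trans (sym (*-assoc b 2 t)) (trans (cong (_* t) (*-comm b 2)) (*-assoc 2 b t))
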